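{- Let $G=(U,V,E)$ be a bipartite graph with $|U|=|V|=n$ and $|E|\ge pn^2$ for some $p\in(0,1]$. Suppose the edges of $G$ are colored so that every vertex of $U\cup V$ is incident to edges of at most $t$ distinct colors. Then some color is used by at least $(pn/t)^2$ edges of $E$.
   Formalization: The parameter p ranges over the rational numbers in (0,1]. -}

module Defs where

open import Data.Bool using (Bool; _∧_)
open import Data.Nat using (ℕ; _≡ᵇ_)
open import Data.Nat.Properties using (_≟_)
open import Data.Fin using (Fin)
open import Data.List using (List; length; map; filterᵇ; allFin; cartesianProduct; deduplicate)
open import Data.Product using (_×_; _,_)
open import Data.Integer using (+_)
open import Data.Rational using (ℚ; _/_)

-- A bipartite graph G = (U, V, E) with |U| = |V| = n:
-- U = V = Fin n (two disjoint copies), and the edge set is given by a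
-- Boolean adjacency relation  E u v  (u ∈ U, v ∈ V).
BipGraph : ℕ → Set
BipGraph n = Fin n → Fin n → Bool

-- An edge colouring: every pair (u , v) gets a colour (colours are natural
-- numbers; only the colours of actual edges matter).
Colouring : ℕ → Set
Colouring n = Fin n → Fin n → ℕ

allPairs : (n : ℕ) → List (Fin n × Fin n)
allPairs n = cartesianProduct (allFin n) (allFin n)

edgeCount : (n : ℕ) → BipGraph n → ℕ
edgeCount n E = length (filterᵇ (λ { (u , v) → E u v }) (allPairs n))

colourCount : (n : ℕ) → BipGraph n → Colouring n → ℕ → ℕ
colourCount n E c k =
  length (filterᵇ (λ { (u , v) → E u v ∧ (c u v ≡ᵇ k) }) (allPairs n))

coloursAtU : (n : ℕ) → BipGraph n → Colouring n → Fin n → List ℕ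
coloursAtU n E c u = deduplicate _≟_ (map (λ v → c u v) (filterᵇ (λ v → E u v) (allFin n)))

coloursAtV : (n : ℕ) → BipGraph n → Colouring n → Fin n → List ℕ
coloursAtV n E c v = deduplicate _≟_ (map (λ u → c u v) (filterᵇ (λ u → E u v) (allFin n)))

ℕtoℚ : ℕ → ℚ
ℕtoℚ k = + k / 1

module Submission where

-- Write e k for the number of edges of colour k, and a k (b k) for the number of
-- vertices of U (of V) incident to an edge of colour k.  Every edge of colour k joins
-- one of the a k vertices to one of the b k vertices, so e k ≤ a k · b k.  Summing over
-- the colours, ∑ e = |E|, while ∑ a ≤ n t and ∑ b ≤ n t because each vertex sees at
-- most t colours.  With M the largest e k, the AM–GM inequality gives
-- 2 e i · e j ≤ M (a i · b j + a j · b i) for every pair of colours, and summing over all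
-- pairs yields |E|² ≤ M · ∑ a · ∑ b ≤ M (n t)².  Together with p n² ≤ |E| this is
-- (p n / t)² ≤ M, so the most frequent colour is the required one.


module FiniteSums where

  open import Data.Bool using (Bool; true; false; T; _∧_; _∨_)
  open import Data.Nat using (ℕ; zero; suc; _+_; _*_; _≤_; z≤n; s≤s; _≡ᵇ_; _<ᵇ_)
  open import Data.Nat.Properties
  open import Data.List using (List; []; _∷_; _++_; map; length; filterᵇ; cartesianProduct; downFrom)
  open import Data.Bool.ListAction using (any)
  open import Data.List.Membership.Propositional using (_∈_)
  open import Data.List.Relation.Unary.Any using (here; there)
  open import Data.Product using (_×_; _,_)
  open import Relation.Binary.PropositionalEquality
  open import Algebra.Properties.CommutativeSemigroup +-commutativeSemigroup using (interchange)

  ∑ : {A : Set} → List A → (A → ℕ) → ℕ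
  ∑ [] f = 0
  ∑ (x ∷ xs) f = f x + ∑ xs f

  syntax ∑ xs (λ x → e) = ∑[ x ∈ xs ] e

  module _ {A : Set} where

    ∑-cong : (xs : List A) {f g : A → ℕ} → (∀ x → f x ≡ g x) → ∑ xs f ≡ ∑ xs g
    ∑-cong [] f≗g = refl
    ∑-cong (x ∷ xs) f≗g = cong₂ _+_ (f≗g x) (∑-cong xs f≗g)

    ∑-mono : (xs : List A) {f g : A → ℕ} → (∀ {x} → x ∈ xs → f x ≤ g x) → ∑ xs f ≤ ∑ xs g
    ∑-mono [] f≤g = z≤n
    ∑-mono (x ∷ xs) f≤g = +-mono-≤ (f≤g (here refl)) (∑-mono xs (λ x∈xs → f≤g (there x∈xs)))

    term≤∑ : {x : A} {xs : List A} (f : A → ℕ) → x ∈ xs → f x ≤ ∑ xs f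
    term≤∑ f (here refl) = m≤m+n _ _
    term≤∑ {xs = y ∷ ys} f (there x∈ys) = ≤-trans (term≤∑ f x∈ys) (m≤n+m _ (f y))

    ∑-+ : (xs : List A) (f g : A → ℕ) → ∑[ x ∈ xs ] (f x + g x) ≡ ∑ xs f + ∑ xs g
    ∑-+ [] f g = refl
    ∑-+ (x ∷ xs) f g = trans (cong (f x + g x +_) (∑-+ xs f g)) (interchange (f x) (g x) _ _)

    ∑-*ˡ : (xs : List A) (k : ℕ) (f : A → ℕ) → ∑[ x ∈ xs ] (k * f x) ≡ k * ∑ xs f
    ∑-*ˡ [] k f = sym (*-zeroʳ k)
    ∑-*ˡ (x ∷ xs) k f = trans (cong (k * f x +_) (∑-*ˡ xs k f)) (sym (*-distribˡ-+ k (f x) _))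

    ∑-*ʳ : (xs : List A) (k : ℕ) (f : A → ℕ) → ∑[ x ∈ xs ] (f x * k) ≡ ∑ xs f * k
    ∑-*ʳ xs k f = trans (∑-cong xs (λ x → *-comm (f x) k)) (trans (∑-*ˡ xs k f) (*-comm k _))

    ∑-const : (xs : List A) (k : ℕ) → ∑[ x ∈ xs ] k ≡ length xs * k
    ∑-const [] k = refl
    ∑-const (x ∷ xs) k = cong (k +_) (∑-const xs k)

    ∑-++ : (xs ys : List A) (f : A → ℕ) → ∑ (xs ++ ys) f ≡ ∑ xs f + ∑ ys f
    ∑-++ [] ys f = refl
    ∑-++ (x ∷ xs) ys f = trans (cong (f x +_) (∑-++ xs ys f)) (sym (+-assoc (f x) _ _))

  ∑-map : {A B : Set} (xs : List A) (g : A → B) (f : B → ℕ) → ∑ (map g xs) f ≡ ∑[ x ∈ xs ] f (g x)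
  ∑-map [] g f = refl
  ∑-map (x ∷ xs) g f = cong (f (g x) +_) (∑-map xs g f)

  ∑-cartesianProduct : {A B : Set} (xs : List A) (ys : List B) (f : A × B → ℕ) →
    ∑ (cartesianProduct xs ys) f ≡ ∑[ x ∈ xs ] ∑[ y ∈ ys ] f (x , y)
  ∑-cartesianProduct [] ys f = refl
  ∑-cartesianProduct (x ∷ xs) ys f =
    trans (∑-++ (map (x ,_) ys) _ f) (cong₂ _+_ (∑-map ys (x ,_) f) (∑-cartesianProduct xs ys f))

  ∑-comm : {A B : Set} (xs : List A) (ys : List B) (f : A → B → ℕ) →
    ∑[ x ∈ xs ] ∑ ys (f x) ≡ ∑[ y ∈ ys ] ∑[ x ∈ xs ] f x y
  ∑-comm [] ys f = sym (trans (∑-const ys 0) (*-zeroʳ (length ys)))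
  ∑-comm (x ∷ xs) ys f =
    trans (cong (∑ ys (f x) +_) (∑-comm xs ys f)) (sym (∑-+ ys (f x) (λ y → ∑[ x′ ∈ xs ] f x′ y)))

  ∑-*-∑ : {A B : Set} (xs : List A) (ys : List B) (f : A → ℕ) (g : B → ℕ) →
    ∑ xs f * ∑ ys g ≡ ∑[ x ∈ xs ] ∑[ y ∈ ys ] (f x * g y)
  ∑-*-∑ xs ys f g = trans (sym (∑-*ʳ xs (∑ ys g) f)) (∑-cong xs (λ x → sym (∑-*ˡ ys (f x) g)))

  𝟙 : Bool → ℕ
  𝟙 true = 1
  𝟙 false = 0

  𝟙-∧ : ∀ a b → 𝟙 (a ∧ b) ≡ 𝟙 a * 𝟙 b
  𝟙-∧ true b = sym (+-identityʳ (𝟙 b))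
  𝟙-∧ false b = refl

  𝟙-∨ : ∀ a b → 𝟙 (a ∨ b) ≤ 𝟙 a + 𝟙 b
  𝟙-∨ true b = s≤s z≤n
  𝟙-∨ false b = ≤-refl

  𝟙≤1 : ∀ b → 𝟙 b ≤ 1
  𝟙≤1 true = ≤-refl
  𝟙≤1 false = z≤n

  𝟙-T : ∀ {b} → T b → 𝟙 b ≡ 1
  𝟙-T {true} _ = refl

  𝟙-≤ : ∀ {b n} → (T b → 1 ≤ n) → 𝟙 b ≤ n
  𝟙-≤ {true} h = h _
  𝟙-≤ {false} h = z≤n

  length-filterᵇ : {A : Set} (P : A → Bool) (xs : List A) → length (filterᵇ P xs) ≡ ∑[ x ∈ xs ] 𝟙 (P x)
  length-filterᵇ P [] = refl
  length-filterᵇ P (x ∷ xs) with P x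
  ... | true = cong suc (length-filterᵇ P xs)
  ... | false = length-filterᵇ P xs

  ∑-≡ᵇ-downFrom : ∀ m C → ∑[ k ∈ downFrom C ] 𝟙 (m ≡ᵇ k) ≡ 𝟙 (m <ᵇ C)
  ∑-≡ᵇ-downFrom m zero = refl
  ∑-≡ᵇ-downFrom m (suc C) = trans (cong (𝟙 (m ≡ᵇ C) +_) (∑-≡ᵇ-downFrom m C)) (split m C)
    where
    split : ∀ m C → 𝟙 (m ≡ᵇ C) + 𝟙 (m <ᵇ C) ≡ 𝟙 (m <ᵇ suc C)
    split zero zero = refl
    split zero (suc C) = refl
    split (suc m) zero = refl
    split (suc m) (suc C) = split m C

  ∑-occurs≤length : ∀ C (L : List ℕ) → ∑[ k ∈ downFrom C ] 𝟙 (any (_≡ᵇ k) L) ≤ length L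
  ∑-occurs≤length C [] = ≤-reflexive (trans (∑-const (downFrom C) 0) (*-zeroʳ (length (downFrom C))))
  ∑-occurs≤length C (x ∷ L) = begin
    ∑[ k ∈ ks ] 𝟙 ((x ≡ᵇ k) ∨ any (_≡ᵇ k) L)           ≤⟨ ∑-mono ks (λ {k} _ → 𝟙-∨ (x ≡ᵇ k) _) ⟩
    ∑[ k ∈ ks ] (𝟙 (x ≡ᵇ k) + 𝟙 (any (_≡ᵇ k) L))        ≡⟨ ∑-+ ks _ _ ⟩
    ∑[ k ∈ ks ] 𝟙 (x ≡ᵇ k) + ∑[ k ∈ ks ] 𝟙 (any (_≡ᵇ k) L) ≤⟨ +-mono-≤ (≤-trans (≤-reflexive (∑-≡ᵇ-downFrom x C)) (𝟙≤1 _)) (∑-occurs≤length C L) ⟩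
    suc (length L)                                       ∎
    where
    open ≤-Reasoning
    ks : List ℕ
    ks = downFrom C

module Inequalities where

  open FiniteSums
  open import Data.Nat using (ℕ; _+_; _*_; _∸_; _≤_)
  open import Data.Nat.Properties
  open import Data.Nat.Solver using (module +-*-Solver)
  open +-*-Solver using (solve; _:*_; _:+_; _:=_; con)
  open import Data.List using (List)
  open import Data.List.Membership.Propositional using (_∈_)
  open import Data.Sum using (inj₁; inj₂)
  open import Relation.Nullary using (yes; no; contradiction)
  open import Relation.Binary.PropositionalEquality

  -- Squaring is strictly monotone, so it reflects ≤.
  square-cancel-≤ : ∀ {a b} → a * a ≤ b * b → a ≤ b
  square-cancel-≤ {a} {b} a²≤b² with a ≤? b
  ... | yes a≤b = a≤b
  ... | no a≰b = contradiction a²≤b² (<⇒≱ (*-mono-< (≰⇒> a≰b) (≰⇒> a≰b)))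

  -- AM–GM for x ≤ y: writing y = x + d, the difference (x + y)² - 4xy is d².
  am-gm-ordered : ∀ {x y} → x ≤ y → 4 * (x * y) ≤ (x + y) * (x + y)
  am-gm-ordered {x} x≤y = subst (λ y → 4 * (x * y) ≤ (x + y) * (x + y)) (m+[n∸m]≡n x≤y) (shifted (_ ∸ x))
    where
    shifted : ∀ d → 4 * (x * (x + d)) ≤ (x + (x + d)) * (x + (x + d))
    shifted d = subst (4 * (x * (x + d)) ≤_)
      (solve 2 (λ X D → con 4 :* (X :* (X :+ D)) :+ D :* D := (X :+ (X :+ D)) :* (X :+ (X :+ D))) refl x d)
      (m≤m+n _ (d * d))

  am-gm : ∀ x y → 4 * (x * y) ≤ (x + y) * (x + y)
  am-gm x y with ≤-total x y
  ... | inj₁ x≤y = am-gm-ordered x≤y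
  ... | inj₂ y≤x = subst₂ _≤_ (cong (4 *_) (*-comm y x)) (cong₂ _*_ (+-comm y x) (+-comm y x)) (am-gm-ordered y≤x)

  -- If e ≤ AB, e′ ≤ A′B′ and e, e′ ≤ M, then 2ee′ ≤ M(AB′ + A′B):
  -- compare squares and apply AM–GM to AB′ and A′B.
  cross-bound : ∀ {e e′ A B A′ B′ M} → e ≤ A * B → e ≤ M → e′ ≤ A′ * B′ → e′ ≤ M →
                2 * (e * e′) ≤ M * (A * B′ + A′ * B)
  cross-bound {e} {e′} {A} {B} {A′} {B′} {M} e≤AB e≤M e′≤A′B′ e′≤M = square-cancel-≤ (begin
    (2 * (e * e′)) * (2 * (e * e′))
      ≡⟨ solve 2 (λ E E′ → (con 2 :* (E :* E′)) :* (con 2 :* (E :* E′)) := con 4 :* ((E :* E) :* (E′ :* E′))) refl e e′ ⟩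
    4 * ((e * e) * (e′ * e′))
      ≤⟨ *-monoʳ-≤ 4 (*-mono-≤ (*-mono-≤ e≤M e≤AB) (*-mono-≤ e′≤M e′≤A′B′)) ⟩
    4 * ((M * (A * B)) * (M * (A′ * B′)))
      ≡⟨ solve 5 (λ M A B A′ B′ → con 4 :* ((M :* (A :* B)) :* (M :* (A′ :* B′))) := (M :* M) :* (con 4 :* ((A :* B′) :* (A′ :* B)))) refl M A B A′ B′ ⟩
    (M * M) * (4 * ((A * B′) * (A′ * B)))
      ≤⟨ *-monoʳ-≤ (M * M) (am-gm (A * B′) (A′ * B)) ⟩
    (M * M) * ((A * B′ + A′ * B) * (A * B′ + A′ * B))
      ≡⟨ solve 3 (λ M X Y → (M :* M) :* ((X :+ Y) :* (X :+ Y)) := (M :* (X :+ Y)) :* (M :* (X :+ Y))) refl M (A * B′) (A′ * B) ⟩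
    (M * (A * B′ + A′ * B)) * (M * (A * B′ + A′ * B)) ∎)
    where open ≤-Reasoning

  -- A Cauchy–Schwarz type bound: if every term satisfies e k ≤ a k · b k and e k ≤ M,
  -- then (∑ e)² ≤ M · ∑ a · ∑ b.  Sum cross-bound over all pairs of indices.
  ∑-square-bound : {A : Set} (ks : List A) (M : ℕ) (e a b : A → ℕ) →
    (∀ k → e k ≤ a k * b k) → (∀ {k} → k ∈ ks → e k ≤ M) →
    ∑ ks e * ∑ ks e ≤ M * (∑ ks a * ∑ ks b)
  ∑-square-bound ks M e a b e≤ab e≤M = *-cancelˡ-≤ 2 (begin
    2 * (S * S)
      ≡⟨ cong (2 *_) (∑-*-∑ ks ks e e) ⟩
    2 * ∑[ i ∈ ks ] ∑[ j ∈ ks ] (e i * e j)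
      ≡⟨ sym (trans (∑-cong ks (λ i → ∑-*ˡ ks 2 (λ j → e i * e j))) (∑-*ˡ ks 2 _)) ⟩
    ∑[ i ∈ ks ] ∑[ j ∈ ks ] (2 * (e i * e j))
      ≤⟨ ∑-mono ks (λ {i} i∈ks → ∑-mono ks (λ {j} j∈ks →
           cross-bound {A = a i} {b i} {a j} {b j} (e≤ab i) (e≤M i∈ks) (e≤ab j) (e≤M j∈ks))) ⟩
    ∑[ i ∈ ks ] ∑[ j ∈ ks ] (M * (a i * b j + a j * b i))
      ≡⟨ trans (∑-cong ks (λ i → ∑-*ˡ ks M _)) (∑-*ˡ ks M _) ⟩
    M * ∑[ i ∈ ks ] ∑[ j ∈ ks ] (a i * b j + a j * b i)
      ≡⟨ cong (M *_) cross-terms ⟩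
    M * (SA * SB + SA * SB)
      ≡⟨ solve 2 (λ M X → M :* (X :+ X) := con 2 :* (M :* X)) refl M (SA * SB) ⟩
    2 * (M * (SA * SB)) ∎)
    where
    open ≤-Reasoning
    S SA SB : ℕ
    S = ∑ ks e
    SA = ∑ ks a
    SB = ∑ ks b
    cross-terms : ∑[ i ∈ ks ] ∑[ j ∈ ks ] (a i * b j + a j * b i) ≡ SA * SB + SA * SB
    cross-terms = begin-equality
      ∑[ i ∈ ks ] ∑[ j ∈ ks ] (a i * b j + a j * b i)
        ≡⟨ trans (∑-cong ks (λ i → ∑-+ ks _ _)) (∑-+ ks _ _) ⟩
      ∑[ i ∈ ks ] ∑[ j ∈ ks ] (a i * b j) + ∑[ i ∈ ks ] ∑[ j ∈ ks ] (a j * b i)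
        ≡⟨ cong₂ _+_ (sym (∑-*-∑ ks ks a b)) (trans (∑-comm ks ks (λ i j → a j * b i)) (sym (∑-*-∑ ks ks a b))) ⟩
      SA * SB + SA * SB ∎

module ColourCounting where

  open import Defs
  open FiniteSums
  open Inequalities using (∑-square-bound)
  open import Data.List.Extrema.Nat using (argmax; f[xs]≤f[argmax])
  import Data.List.Relation.Unary.All as All
  open import Data.Bool using (T; _∧_)
  open import Data.Bool.Properties using (T-∧)
  open import Data.Bool.ListAction using (any)
  open import Data.Nat using (ℕ; suc; _*_; _≤_; _<_; _≡ᵇ_; _<ᵇ_; s≤s)
  open import Data.Nat.Properties
  open import Data.Fin using (Fin)
  open import Data.List using (List; length; allFin; downFrom)
  open import Data.List.Membership.Propositional using (_∈_)
  open import Data.List.Membership.Propositional.Properties using (∈-deduplicate⁺; ∈-map⁺; ∈-filter⁺; ∈-allFin)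
  open import Data.List.Properties using (length-tabulate)
  open import Data.List.Relation.Unary.Any.Properties using (any⁺)
  import Data.List.Relation.Unary.Any as Any
  open import Data.Product using (_,_)
  open import Function using (Equivalence; id)
  open import Relation.Binary.PropositionalEquality
  open import Relation.Nullary.Decidable using (T?)

  present : List ℕ → ℕ → ℕ
  present L k = 𝟙 (any (_≡ᵇ k) L)

  present-∈ : ∀ {k L} → k ∈ L → present L k ≡ 1
  present-∈ {k} k∈L = 𝟙-T (any⁺ (_≡ᵇ k) (Any.map (λ k≡x → ≡⇒≡ᵇ _ _ (sym k≡x)) k∈L))

  ∑-present≤ : {A : Set} (C t : ℕ) (xs : List A) (L : A → List ℕ) → (∀ x → length (L x) ≤ t) →
    ∑[ k ∈ downFrom C ] ∑[ x ∈ xs ] present (L x) k ≤ length xs * t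
  ∑-present≤ C t xs L |L|≤t = begin
    ∑[ k ∈ downFrom C ] ∑[ x ∈ xs ] present (L x) k ≡⟨ sym (∑-comm xs (downFrom C) (λ x → present (L x))) ⟩
    ∑[ x ∈ xs ] ∑[ k ∈ downFrom C ] present (L x) k ≤⟨ ∑-mono xs (λ {x} _ → ≤-trans (∑-occurs≤length C (L x)) (|L|≤t x)) ⟩
    ∑[ x ∈ xs ] t                                  ≡⟨ ∑-const xs t ⟩
    length xs * t                                  ∎
    where open ≤-Reasoning

  module DoubleCounting (n : ℕ) (E : BipGraph n) (c : Colouring n) where

    vertices : List (Fin n)
    vertices = allFin n

    length-vertices : length vertices ≡ n
    length-vertices = length-tabulate id

    edgeOfColour : Fin n → Fin n → ℕ → ℕ
    edgeOfColour u v k = 𝟙 (E u v ∧ (c u v ≡ᵇ k))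

    edgeCount-∑ : edgeCount n E ≡ ∑[ u ∈ vertices ] ∑[ v ∈ vertices ] 𝟙 (E u v)
    edgeCount-∑ = trans (length-filterᵇ _ (allPairs n)) (∑-cartesianProduct vertices vertices _)

    colourCount-∑ : ∀ k → colourCount n E c k ≡ ∑[ u ∈ vertices ] ∑[ v ∈ vertices ] edgeOfColour u v k
    colourCount-∑ k = trans (length-filterᵇ _ (allPairs n)) (∑-cartesianProduct vertices vertices _)

    -- All colours in use are below C (each is bounded by the sum of all colours),
    -- so colours = C-1, …, 0 is a finite range containing every colour.
    C : ℕ
    C = suc (∑[ u ∈ vertices ] ∑[ v ∈ vertices ] c u v)

    colours : List ℕ
    colours = downFrom C

    c<C : ∀ u v → c u v < C
    c<C u v = s≤s (≤-trans (term≤∑ (c u) (∈-allFin v)) (term≤∑ (λ u′ → ∑ vertices (c u′)) (∈-allFin u)))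

    edge-∑-colours : ∀ u v → 𝟙 (E u v) ≡ ∑[ k ∈ colours ] edgeOfColour u v k
    edge-∑-colours u v = sym (begin
      ∑[ k ∈ colours ] 𝟙 (E u v ∧ (c u v ≡ᵇ k))       ≡⟨ ∑-cong colours (λ k → 𝟙-∧ (E u v) (c u v ≡ᵇ k)) ⟩
      ∑[ k ∈ colours ] (𝟙 (E u v) * 𝟙 (c u v ≡ᵇ k))  ≡⟨ ∑-*ˡ colours (𝟙 (E u v)) _ ⟩
      𝟙 (E u v) * ∑[ k ∈ colours ] 𝟙 (c u v ≡ᵇ k)    ≡⟨ cong (𝟙 (E u v) *_) (∑-≡ᵇ-downFrom (c u v) C) ⟩
      𝟙 (E u v) * 𝟙 (c u v <ᵇ C)                    ≡⟨ cong (𝟙 (E u v) *_) (𝟙-T (<⇒<ᵇ (c<C u v))) ⟩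
      𝟙 (E u v) * 1                                 ≡⟨ *-identityʳ _ ⟩
      𝟙 (E u v)                                     ∎)
      where open ≡-Reasoning

    edgeCount-∑-colourCount : edgeCount n E ≡ ∑[ k ∈ colours ] colourCount n E c k
    edgeCount-∑-colourCount = begin
      edgeCount n E                                                          ≡⟨ edgeCount-∑ ⟩
      ∑[ u ∈ vertices ] ∑[ v ∈ vertices ] 𝟙 (E u v)                           ≡⟨ ∑-cong vertices (λ u → ∑-cong vertices (edge-∑-colours u)) ⟩
      ∑[ u ∈ vertices ] ∑[ v ∈ vertices ] ∑[ k ∈ colours ] edgeOfColour u v k ≡⟨ ∑-cong vertices (λ u → ∑-comm vertices colours (edgeOfColour u)) ⟩
      ∑[ u ∈ vertices ] ∑[ k ∈ colours ] ∑[ v ∈ vertices ] edgeOfColour u v k ≡⟨ ∑-comm vertices colours _ ⟩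
      ∑[ k ∈ colours ] ∑[ u ∈ vertices ] ∑[ v ∈ vertices ] edgeOfColour u v k ≡⟨ ∑-cong colours (λ k → sym (colourCount-∑ k)) ⟩
      ∑[ k ∈ colours ] colourCount n E c k                                    ∎
      where open ≡-Reasoning

    aU bV : ℕ → ℕ
    aU k = ∑[ u ∈ vertices ] present (coloursAtU n E c u) k
    bV k = ∑[ v ∈ vertices ] present (coloursAtV n E c v) k

    edgeOfColour≤ : ∀ u v k → edgeOfColour u v k ≤ present (coloursAtU n E c u) k * present (coloursAtV n E c v) k
    edgeOfColour≤ u v k = 𝟙-≤ λ Euv∧k →
      let (Euv , c≡ᵇk) = Equivalence.to T-∧ Euv∧k
          c≡k = ≡ᵇ⇒≡ _ _ c≡ᵇk
      in ≤-reflexive (sym (cong₂ _*_ (present-∈ (subst (_∈ coloursAtU n E c u) c≡k (atU Euv)))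
                                     (present-∈ (subst (_∈ coloursAtV n E c v) c≡k (atV Euv)))))
      where
      atU : T (E u v) → c u v ∈ coloursAtU n E c u
      atU Euv = ∈-deduplicate⁺ _≟_ (∈-map⁺ (c u) (∈-filter⁺ (λ w → T? (E u w)) (∈-allFin v) Euv))
      atV : T (E u v) → c u v ∈ coloursAtV n E c v
      atV Euv = ∈-deduplicate⁺ _≟_ (∈-map⁺ (λ w → c w v) (∈-filter⁺ (λ w → T? (E w v)) (∈-allFin u) Euv))

    -- The edges of colour k lie between the aU k and the bV k vertices seeing k.
    colourCount≤aU*bV : ∀ k → colourCount n E c k ≤ aU k * bV k
    colourCount≤aU*bV k = begin
      colourCount n E c k                                                   ≡⟨ colourCount-∑ k ⟩
      ∑[ u ∈ vertices ] ∑[ v ∈ vertices ] edgeOfColour u v k                 ≤⟨ ∑-mono vertices (λ {u} _ → ∑-mono vertices (λ {v} _ → edgeOfColour≤ u v k)) ⟩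
      ∑[ u ∈ vertices ] ∑[ v ∈ vertices ] (present (coloursAtU n E c u) k * present (coloursAtV n E c v) k)
                                                                            ≡⟨ sym (∑-*-∑ vertices vertices _ _) ⟩
      aU k * bV k                                                           ∎
      where open ≤-Reasoning

    module _ (t : ℕ) where
      ∑aU≤ : (∀ u → length (coloursAtU n E c u) ≤ t) → ∑ colours aU ≤ n * t
      ∑aU≤ hU = subst (λ m → ∑ colours aU ≤ m * t) length-vertices (∑-present≤ C t vertices (coloursAtU n E c) hU)

      ∑bV≤ : (∀ v → length (coloursAtV n E c v) ≤ t) → ∑ colours bV ≤ n * t
      ∑bV≤ hV = subst (λ m → ∑ colours bV ≤ m * t) length-vertices (∑-present≤ C t vertices (coloursAtV n E c) hV)

    heaviest : ℕ
    heaviest = argmax (colourCount n E c) 0 colours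

    heaviest-max : ∀ {k} → k ∈ colours → colourCount n E c k ≤ colourCount n E c heaviest
    heaviest-max = All.lookup (f[xs]≤f[argmax] {f = colourCount n E c} 0 colours)

    edgeCount²≤ : (t : ℕ) → (∀ u → length (coloursAtU n E c u) ≤ t) → (∀ v → length (coloursAtV n E c v) ≤ t) →
      edgeCount n E * edgeCount n E ≤ colourCount n E c heaviest * ((n * t) * (n * t))
    edgeCount²≤ t hU hV = begin
      edgeCount n E * edgeCount n E           ≡⟨ cong₂ _*_ edgeCount-∑-colourCount edgeCount-∑-colourCount ⟩
      ∑ colours e * ∑ colours e               ≤⟨ ∑-square-bound colours (e heaviest) e aU bV colourCount≤aU*bV heaviest-max ⟩
      e heaviest * (∑ colours aU * ∑ colours bV) ≤⟨ *-monoʳ-≤ (e heaviest) (*-mono-≤ (∑aU≤ t hU) (∑bV≤ t hV)) ⟩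
      e heaviest * ((n * t) * (n * t))        ∎
      where
      open ≤-Reasoning
      e : ℕ → ℕ
      e = colourCount n E c

module RationalBounds where

  open import Defs
  open import Data.Nat as ℕ using (ℕ; NonZero; zero; suc)
  import Data.Nat.Properties as ℕ
  open import Data.Integer as ℤ using (+_)
  import Data.Integer.Properties as ℤ
  open import Data.Rational using (ℚ; _/_; _*_; _≤_; 0ℚ; toℚᵘ; NonNegative; Positive; nonNegative)
  open import Data.Rational.Properties
  import Data.Rational.Unnormalised as ℚᵘ
  import Data.Rational.Unnormalised.Properties as ℚᵘ
  open import Data.Rational.Solver using (module +-*-Solver)
  open +-*-Solver using (solve; _:*_; _:=_)
  open import Relation.Binary.PropositionalEquality

  toℚᵘ-ℕtoℚ : ∀ a → toℚᵘ (ℕtoℚ a) ℚᵘ.≃ ℚᵘ.mkℚᵘ (+ a) 0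
  toℚᵘ-ℕtoℚ a = toℚᵘ-fromℚᵘ (ℚᵘ.mkℚᵘ (+ a) 0)

  ℕtoℚ-* : ∀ a b → ℕtoℚ a * ℕtoℚ b ≡ ℕtoℚ (a ℕ.* b)
  ℕtoℚ-* a b = toℚᵘ-injective (begin
    toℚᵘ (ℕtoℚ a * ℕtoℚ b)                 ≈⟨ toℚᵘ-homo-* (ℕtoℚ a) (ℕtoℚ b) ⟩
    toℚᵘ (ℕtoℚ a) ℚᵘ.* toℚᵘ (ℕtoℚ b)        ≈⟨ ℚᵘ.*-cong (toℚᵘ-ℕtoℚ a) (toℚᵘ-ℕtoℚ b) ⟩
    ℚᵘ.mkℚᵘ (+ a) 0 ℚᵘ.* ℚᵘ.mkℚᵘ (+ b) 0    ≈⟨ ℚᵘ.*≡* (cong (ℤ._* + 1) (sym (ℤ.pos-* a b))) ⟩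
    ℚᵘ.mkℚᵘ (+ (a ℕ.* b)) 0                ≈⟨ ℚᵘ.≃-sym (toℚᵘ-ℕtoℚ (a ℕ.* b)) ⟩
    toℚᵘ (ℕtoℚ (a ℕ.* b))                  ∎)
    where open ℚᵘ.≃-Reasoning

  ℕtoℚ-mono-≤ : ∀ {a b} → a ℕ.≤ b → ℕtoℚ a ≤ ℕtoℚ b
  ℕtoℚ-mono-≤ {a} {b} a≤b = toℚᵘ-cancel-≤ (begin
    toℚᵘ (ℕtoℚ a)     ≃⟨ toℚᵘ-ℕtoℚ a ⟩
    ℚᵘ.mkℚᵘ (+ a) 0   ≤⟨ ℚᵘ.*≤* (subst₂ ℤ._≤_ (sym (ℤ.*-identityʳ _)) (sym (ℤ.*-identityʳ _)) (ℤ.+≤+ a≤b)) ⟩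
    ℚᵘ.mkℚᵘ (+ b) 0   ≃⟨ ℚᵘ.≃-sym (toℚᵘ-ℕtoℚ b) ⟩
    toℚᵘ (ℕtoℚ b)     ∎)
    where open ℚᵘ.≤-Reasoning

  ℕtoℚ-nonNeg : ∀ a → NonNegative (ℕtoℚ a)
  ℕtoℚ-nonNeg a = normalize-nonNeg a 1

  /-*-cancel : ∀ n t .{{_ : NonZero t}} → (+ n / t) * ℕtoℚ t ≡ ℕtoℚ n
  /-*-cancel n t@(suc t-1) = toℚᵘ-injective (begin
    toℚᵘ ((+ n / t) * ℕtoℚ t)                    ≈⟨ toℚᵘ-homo-* (+ n / t) (ℕtoℚ t) ⟩
    toℚᵘ (+ n / t) ℚᵘ.* toℚᵘ (ℕtoℚ t)            ≈⟨ ℚᵘ.*-cong (toℚᵘ-fromℚᵘ (ℚᵘ.mkℚᵘ (+ n) t-1)) (toℚᵘ-ℕtoℚ t) ⟩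
    ℚᵘ.mkℚᵘ (+ n) t-1 ℚᵘ.* ℚᵘ.mkℚᵘ (+ t) 0       ≈⟨ ℚᵘ.*≡* cross-multiplied ⟩
    ℚᵘ.mkℚᵘ (+ n) 0                              ≈⟨ ℚᵘ.≃-sym (toℚᵘ-ℕtoℚ n) ⟩
    toℚᵘ (ℕtoℚ n)                                ∎)
    where
    open ℚᵘ.≃-Reasoning
    cross-multiplied : (+ n ℤ.* + t) ℤ.* + 1 ≡ + n ℤ.* + suc (t-1 ℕ.* 1)
    cross-multiplied = trans (ℤ.*-identityʳ _) (cong (λ z → + n ℤ.* + suc z) (sym (ℕ.*-identityʳ t-1)))

  square-bound : (q : ℚ) .{{_ : NonNegative q}} (Q S M : ℕ) .{{_ : NonZero Q}} →
    q * ℕtoℚ Q ≤ ℕtoℚ S → S ℕ.* S ℕ.≤ M ℕ.* (Q ℕ.* Q) → q * q ≤ ℕtoℚ M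
  square-bound q Q S M qQ≤S S²≤MQ² = *-cancelʳ-≤-pos (ℕtoℚ Q * ℕtoℚ Q) {{Q²-pos}} (begin
    (q * q) * (ℕtoℚ Q * ℕtoℚ Q)      ≡⟨ solve 2 (λ A B → (A :* A) :* (B :* B) := (A :* B) :* (A :* B)) refl q (ℕtoℚ Q) ⟩
    (q * ℕtoℚ Q) * (q * ℕtoℚ Q)      ≤⟨ *-monoˡ-≤-nonNeg (q * ℕtoℚ Q) qQ≤S ⟩
    (q * ℕtoℚ Q) * ℕtoℚ S            ≤⟨ *-monoʳ-≤-nonNeg (ℕtoℚ S) qQ≤S ⟩
    ℕtoℚ S * ℕtoℚ S                  ≡⟨ ℕtoℚ-* S S ⟩
    ℕtoℚ (S ℕ.* S)                   ≤⟨ ℕtoℚ-mono-≤ S²≤MQ² ⟩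
    ℕtoℚ (M ℕ.* (Q ℕ.* Q))           ≡⟨ sym (trans (cong (ℕtoℚ M *_) (ℕtoℚ-* Q Q)) (ℕtoℚ-* M _)) ⟩
    ℕtoℚ M * (ℕtoℚ Q * ℕtoℚ Q)       ∎)
    where
    open ≤-Reasoning
    instance
      Q-nonNeg : NonNegative (ℕtoℚ Q)
      Q-nonNeg = ℕtoℚ-nonNeg Q
      S-nonNeg : NonNegative (ℕtoℚ S)
      S-nonNeg = ℕtoℚ-nonNeg S
      qQ-nonNeg : NonNegative (q * ℕtoℚ Q)
      qQ-nonNeg = nonNeg*nonNeg⇒nonNeg q (ℕtoℚ Q)
    Q-pos : Positive (ℕtoℚ Q)
    Q-pos = normalize-pos Q 1
    Q²-pos : Positive (ℕtoℚ Q * ℕtoℚ Q)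
    Q²-pos = pos*pos⇒pos (ℕtoℚ Q) {{Q-pos}} (ℕtoℚ Q) {{Q-pos}}

  density-bound : (n t : ℕ) .{{_ : NonZero t}} (p : ℚ) → 0ℚ ≤ p → (S M : ℕ) →
    p * ℕtoℚ (n ℕ.* n) ≤ ℕtoℚ S → S ℕ.* S ℕ.≤ M ℕ.* ((n ℕ.* t) ℕ.* (n ℕ.* t)) →
    (p * (+ n / t)) * (p * (+ n / t)) ≤ ℕtoℚ M
  density-bound zero t p 0≤p S M _ _ = begin
    (p * (+ 0 / t)) * (p * (+ 0 / t)) ≡⟨ cong (λ z → (p * z) * (p * z)) (0/n≡0 t) ⟩
    (p * 0ℚ) * (p * 0ℚ)               ≡⟨ trans (cong (λ z → z * z) (*-zeroʳ p)) (*-zeroʳ 0ℚ) ⟩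
    0ℚ                                ≤⟨ nonNegative⁻¹ (ℕtoℚ M) {{ℕtoℚ-nonNeg M}} ⟩
    ℕtoℚ M                            ∎
    where open ≤-Reasoning
  density-bound n@(suc _) t p 0≤p S M pn²≤S S²≤M[nt]² =
    square-bound (p * (+ n / t)) (n ℕ.* t) S M (subst (_≤ ℕtoℚ S) (sym scaled) pn²≤S) S²≤M[nt]²
    where
    instance
      p-nonNeg : NonNegative p
      p-nonNeg = nonNegative 0≤p
      n/t-nonNeg : NonNegative (+ n / t)
      n/t-nonNeg = normalize-nonNeg n t
      q-nonNeg : NonNegative (p * (+ n / t))
      q-nonNeg = nonNeg*nonNeg⇒nonNeg p (+ n / t)
      nt-nonZero : NonZero (n ℕ.* t)
      nt-nonZero = ℕ.m*n≢0 n t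
    scaled : (p * (+ n / t)) * ℕtoℚ (n ℕ.* t) ≡ p * ℕtoℚ (n ℕ.* n)
    scaled = begin
      (p * (+ n / t)) * ℕtoℚ (n ℕ.* t)         ≡⟨ cong ((p * (+ n / t)) *_) (sym (ℕtoℚ-* n t)) ⟩
      (p * (+ n / t)) * (ℕtoℚ n * ℕtoℚ t)      ≡⟨ solve 4 (λ P X N T → (P :* X) :* (N :* T) := (P :* N) :* (X :* T)) refl p (+ n / t) (ℕtoℚ n) (ℕtoℚ t) ⟩
      (p * ℕtoℚ n) * ((+ n / t) * ℕtoℚ t)      ≡⟨ cong ((p * ℕtoℚ n) *_) (/-*-cancel n t) ⟩
      (p * ℕtoℚ n) * ℕtoℚ n                    ≡⟨ trans (*-assoc p (ℕtoℚ n) (ℕtoℚ n)) (cong (p *_) (ℕtoℚ-* n n)) ⟩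
      p * ℕtoℚ (n ℕ.* n)                       ∎
      where open ≡-Reasoning

open import Defs
open import Data.Nat using (ℕ; NonZero)
open import Data.Fin using (Fin)
open import Data.List using (length)
open import Data.Product using (Σ; _,_)
open import Data.Integer using (+_)
open import Data.Rational using (ℚ; _/_; _*_; _≤_; _<_; 0ℚ; 1ℚ)
open import Data.Rational.Properties using (<⇒≤)
open ColourCounting using (module DoubleCounting)
open RationalBounds using (density-bound)

-- The heaviest colour class has M edges with |E|² ≤ M (n t)² (edgeCount²≤); with
-- p n² ≤ |E| this gives (p n / t)² ≤ M.
mainTheorem2 : (n t : ℕ) → .{{_ : NonZero t}} → (p : ℚ) → 0ℚ < p → p ≤ 1ℚ →
    (E : BipGraph n) → (c : Colouring n) →
    p * ℕtoℚ (n Data.Nat.* n) ≤ ℕtoℚ (edgeCount n E) →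
    ((u : Fin n) → length (coloursAtU n E c u) Data.Nat.≤ t) →
    ((v : Fin n) → length (coloursAtV n E c v) Data.Nat.≤ t) →
    Σ ℕ (λ k → (p * (+ n / t)) * (p * (+ n / t)) ≤ ℕtoℚ (colourCount n E c k))
mainTheorem2 n t p 0<p _ E c pn²≤|E| hU hV =
  heaviest , density-bound n t p (<⇒≤ 0<p) (edgeCount n E) (colourCount n E c heaviest) pn²≤|E| (edgeCount²≤ t hU hV)
  where open DoubleCounting n E c
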